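{- Let $P$ be a finite poset with minimum element $\hat{0}$, let $\rho:P\to\mathbb{N}$ be any function, and let $m\in\mathbb{N}$ with $\rho(P):=\max_{x\in P}\rho(x)\le m$. Let $(S_1,\dots,S_n)$ be an ordered collection of subsets of $P$, each containing $\hat{0}$, and let $f:\prod_{i=1}^n RT_{S_i}\to P$ be a transversal function. Suppose: (1) if $x\le y$ in $P$ and $\mathbf{s}\in\mathcal{T}_x$, then there exists $\mathbf{t}\in\mathcal{T}_y$ with $\mathbf{s}\le\mathbf{t}$; (2) if $\mathbf{t}\in\mathcal{T}_x^a$, then $|\operatorname{supp}\mathbf{t}|=\rho(x)$; (3) the summation condition holds for every class $\mathcal{T}_x$, i.e. for every $x\neq\hat{0}$, $\sum_{\mathbf{s}\in L(\mathcal{T}_x)}\mu(\mathbf{s})=0$, where $L(\mathcal{T}_x)$ is the lower order ideal of $\prod_i RT_{S_i}$ generated by $\mathcal{T}_x$ and $\mu$ is the Möbius function of $\prod_i RT_{S_i}$. Then: (a) $P\cong\left(\prod_{i=1}^n RT_{S_i}\right)/\ker f$; (b) for each $x\in P$, $\mu(x)=(-1)^{\rho(x)}|\mathcal{T}_x^a|$; (c) $\chi(P,t)=t^{m-n}\prod_{i=1}^n\bigl(t-|A(RT_{S_i})|\bigr)$, where $A(RT_{S_i})$ is the set of atoms of $RT_{S_i}$.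
   Context: All posets are finite with a minimum element $\hat{0}$. The Möbius function of such a poset $Q$ is the unique $\mu:Q\to\mathbb{Z}$ with $\sum_{y\le x}\mu(y)=\delta_{\hat{0},x}$ for all $x$ (i.e. $\mu(x)=\mu(\hat 0,x)$). For $\rho:P\to\mathbb{N}$ and $m\ge\rho(P)$, the characteristic polynomial of $P$ with respect to $\rho$ and $m$ is $\chi(P,t)=\sum_{x\in P}\mu(x)t^{m-\rho(x)}$. For $S\subseteq P$ with $\hat{0}\in S$, the rooted tree $RT_S$ is the set of saturated chains of $P$ that start at $\hat{0}$ and use only elements of $S$, ordered by containment; its minimum is the one-element chain $\hat 0$, and an element of $RT_S$ is often identified with the top element of the chain. Elements of $\prod_i RT_{S_i}$ (ordered componentwise) are written $\mathbf{t}=(t_1,\dots,t_n)$. A transversal function is a map $f:\prod_{i=1}^nRT_{S_i}\to P$ that is order preserving, surjective, and such that $f(\mathbf{t})=\hat{0}$ implies $t_i=\hat{0}$ for all $i$. Its kernel $\ker f$ is the equivalence relation $\mathbf{s}\sim\mathbf{t}\iff f(\mathbf{s})=f(\mathbf{t})$. $\mathcal{T}_x=f^{ -1}(x)$ is the set of transversals for $x$; $\mathbf{t}$ is atomic if each $t_i$ is either $\hat{0}$ or an atom of $RT_{S_i}$; $\mathcal{T}_x^a$ is the set of atomic transversals for $x$; $\operatorname{supp}\mathbf{t}=\{i:t_i\ne\hat{0}\}$. For an equivalence relation $\sim$ on a poset $Q$, the quotient $Q/\sim$ is the set of classes with $X\le Y$ iff $x\le y$ for some $x\in X$, $y\in Y$.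 -}

module Defs where

open import Level using (0ℓ)
open import Data.Bool using (Bool; true; false; _∧_; T)
open import Data.Nat as ℕ using (ℕ; zero; suc)
open import Data.Integer as ℤ using (ℤ; 0ℤ; 1ℤ)
open import Data.Fin using (Fin; _≟_)
open import Data.Fin.Properties using (all?)
open import Data.Fin.Subset using (Subset)
open import Data.Vec using (Vec; []; _∷_; lookup)
open import Data.Vec.Relation.Unary.All as VAll using ([]; _∷_)
open import Data.List using (List; []; _∷_; map; foldr; length; allFin)
open import Data.List.Membership.Propositional using (_∈_)
open import Data.List.Relation.Binary.Subset.Propositional using (_⊆_)
open import Data.List.Relation.Unary.Unique.Propositional using (Unique)
open import Data.Product using (Σ; Σ-syntax; _×_; _,_; proj₁)
open import Data.Sum using (_⊎_)
open import Data.Unit using (⊤; tt)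
open import Function.Bundles using (_⇔_)
open import Relation.Nullary using (¬_; Dec; ¬?; yes; no)
open import Relation.Nullary.Decidable using (⌊_⌋; _×-dec_; _→-dec_)
open import Relation.Binary using (Decidable; IsPartialOrder)
open import Relation.Binary.PropositionalEquality using (_≡_; _≢_)

sumℤ : List ℤ → ℤ
sumℤ = foldr ℤ._+_ 0ℤ

prodℤ : List ℤ → ℤ
prodℤ = foldr ℤ._*_ 1ℤ

Enumerates : {A : Set} → List A → (A → Set) → Set
Enumerates {A} L P = Unique L × ((a : A) → (a ∈ L ⇔ P a))

SumsTo : {A : Set} → (A → Set) → (A → ℤ) → ℤ → Set
SumsTo P g z = ∀ L → Enumerates L P → sumℤ (map g L) ≡ z

Card : {A : Set} → (A → Set) → ℕ → Set
Card P k = Σ[ L ∈ List _ ] (Enumerates L P × length L ≡ k)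

IsMobius : {A : Set} → (A → A → Set) → A → (A → ℤ) → Set
IsMobius {A} _≤_ z μ = (x : A) →
  ((x ≡ z) → SumsTo (λ y → y ≤ x) μ 1ℤ) × ((x ≢ z) → SumsTo (λ y → y ≤ x) μ 0ℤ)

record FinPoset (N : ℕ) : Set₁ where
  field
    _≤P_           : Fin N → Fin N → Set
    _≤?_           : Decidable _≤P_
    isPartialOrder : IsPartialOrder _≡_ _≤P_
    bot            : Fin N
    bot-min        : (x : Fin N) → bot ≤P x

  _<_ : Fin N → Fin N → Set
  x < y = (x ≤P y) × (x ≢ y)

  _<?_ : Decidable _<_
  x <? y = (x ≤? y) ×-dec ¬? (x ≟ y)

  _⋖_ : Fin N → Fin N → Set
  x ⋖ y = (x < y) × ((z : Fin N) → x < z → ¬ (z < y))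

  _⋖?_ : Decidable _⋖_
  x ⋖? y = (x <? y) ×-dec all? (λ z → (x <? z) →-dec ¬? (z <? y))

  -- Rooted tree RT_S of saturated chains 0̂ = c₀ ⋖ c₁ ⋖ ... ⋖ c_k with
  -- all cᵢ ∈ S.  An element is stored as the list [c₁,...,c_k]
  -- (the full chain being  bot ∷ that list).

  satFrom : Subset N → Fin N → List (Fin N) → Bool
  satFrom S x []       = true
  satFrom S x (y ∷ ys) = ⌊ x ⋖? y ⌋ ∧ (lookup S y ∧ satFrom S y ys)

  RT : Subset N → Set
  RT S = Σ[ cs ∈ List (Fin N) ] T (satFrom S bot cs)

  chain : {S : Subset N} → RT S → List (Fin N)
  chain (cs , _) = bot ∷ cs

  _≤RT_ : {S : Subset N} → RT S → RT S → Set
  a ≤RT b = chain a ⊆ chain b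

  _<RT_ : {S : Subset N} → RT S → RT S → Set
  a <RT b = (a ≤RT b) × (a ≢ b)

  root : (S : Subset N) → RT S
  root S = [] , tt

  IsAtomRT : {S : Subset N} → RT S → Set
  IsAtomRT {S} a = (root S <RT a) × ((z : RT S) → root S <RT z → ¬ (z <RT a))

  Tup : {n : ℕ} → Vec (Subset N) n → Set
  Tup Ss = VAll.All RT Ss

  _≤T_ : {n : ℕ} {Ss : Vec (Subset N) n} → Tup Ss → Tup Ss → Set
  [] ≤T [] = ⊤
  (a ∷ as) ≤T (b ∷ bs) = (a ≤RT b) × (as ≤T bs)

  minT : {n : ℕ} (Ss : Vec (Subset N) n) → Tup Ss
  minT []       = []
  minT (S ∷ Ss) = root S ∷ minT Ss

  AllZero : {n : ℕ} {Ss : Vec (Subset N) n} → Tup Ss → Set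
  AllZero {Ss = []} [] = ⊤
  AllZero {Ss = S ∷ Ss} (a ∷ as) = (a ≡ root S) × AllZero as

  Atomic : {n : ℕ} {Ss : Vec (Subset N) n} → Tup Ss → Set
  Atomic {Ss = []} [] = ⊤
  Atomic {Ss = S ∷ Ss} (a ∷ as) = ((a ≡ root S) ⊎ IsAtomRT a) × Atomic as

  suppSize : {n : ℕ} {Ss : Vec (Subset N) n} → Tup Ss → ℕ
  suppSize [] = 0
  suppSize (([] , _) ∷ as)    = suppSize as
  suppSize ((_ ∷ _ , _) ∷ as) = suc (suppSize as)

  record IsTransversal {n : ℕ} (Ss : Vec (Subset N) n) (f : Tup Ss → Fin N) : Set where
    field
      monotone   : (s t : Tup Ss) → s ≤T t → f s ≤P f t
      surjective : (x : Fin N) → Σ[ t ∈ Tup Ss ] f t ≡ x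
      zero-fibre : (t : Tup Ss) → f t ≡ bot → AllZero t

  InLowerIdeal : {n : ℕ} {Ss : Vec (Subset N) n} → (Tup Ss → Fin N) → Fin N → Tup Ss → Set
  InLowerIdeal {Ss = Ss} f x s = Σ[ t ∈ Tup Ss ] ((f t ≡ x) × (s ≤T t))

  -- order on the quotient (∏ RT_{S_i})/ker f, expressed on representatives:
  -- [s] ≤ [t]  iff  s' ≤ t' for some s' ~ s, t' ~ t
  _≤Q[_]_ : {n : ℕ} {Ss : Vec (Subset N) n} → Tup Ss → (Tup Ss → Fin N) → Tup Ss → Set
  _≤Q[_]_ {Ss = Ss} s f t = Σ[ s' ∈ Tup Ss ] Σ[ t' ∈ Tup Ss ] ((f s' ≡ f s) × (f t' ≡ f t) × (s' ≤T t'))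

  -- P ≅ (∏ RT_{S_i})/ker f  as posets (quotient presented as a setoid)
  IsoToQuotient : {n : ℕ} (Ss : Vec (Subset N) n) → (Tup Ss → Fin N) → Set
  IsoToQuotient Ss f =
    Σ[ g ∈ (Fin N → Tup Ss) ] Σ[ h ∈ (Tup Ss → Fin N) ]
      (((s t : Tup Ss) → f s ≡ f t → h s ≡ h t)
      × ((x : Fin N) → h (g x) ≡ x)
      × ((t : Tup Ss) → f (g (h t)) ≡ f t)
      × ((x y : Fin N) → (x ≤P y) ⇔ (g x ≤Q[ f ] g y)))

  χ : (Fin N → ℤ) → (Fin N → ℕ) → ℕ → ℤ → ℤ
  χ μ ρ m t = sumℤ (map (λ x → μ x ℤ.* (t ℤ.^ (m ℕ.∸ ρ x))) (allFin N))

-- The Möbius function of a rooted tree is 1 at the root, −1 at the atoms and 0 elsewhere, and that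
-- of ∏ RT_{S_i} is the product of these; so it vanishes off the atomic tuples and is (−1)^{|supp t|}
-- on them. By (1) and monotonicity of f, the tuples mapped below x form exactly the lower ideal
-- L(T_x); hence by (2) and (3), x ↦ (−1)^{ρ(x)} |T_x^a| satisfies the defining recursion of the
-- Möbius function of P, which proves (b). Summing (b) against t^{m−ρ(x)} turns χ(P,t) into a sum
-- over atomic tuples, which factors over the components into ∏ (t − |A(RT_{S_i})|). Part (a) only
-- needs surjectivity and (1).
module Submission where

open import Algebra.Bundles using (CommutativeMonoid)
open import Data.Bool using (T)
open import Data.Bool.Properties using (T-∧; T-irrelevant)
open import Data.Empty using (⊥-elim)
open import Data.Fin as Fin using (Fin; zero; suc)
open import Data.Fin.Induction using (po-wellFounded; po-noetherian)
open import Data.Fin.Subset using (Subset) renaming (_∈_ to _∈ₛ_)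
open import Data.Integer as ℤ using (ℤ; 0ℤ; 1ℤ; -1ℤ; +_; _+_; _*_; _-_; -_; _^_)
import Data.Integer.Properties as ℤ
open import Data.List using (List; []; _∷_; map; length; allFin; filter; _++_; concatMap;
                             cartesianProductWith; deduplicate)
open import Data.List.Properties using (≡-dec; map-tabulate)
open import Data.List.Membership.Propositional using (_∈_)
open import Data.List.Membership.Propositional.Properties
  using (∈-filter⁺; ∈-filter⁻; ∈-deduplicate⁺; ∈-deduplicate⁻; ∈-allFin; ∈-map⁺;
         ∈-concat⁺′; ∈-cartesianProductWith⁺; ∈-cartesianProductWith⁻)
open import Data.List.Membership.Propositional.Properties.WithK using (unique∧set⇒bag)
open import Data.List.Relation.Binary.BagAndSetEquality using (∼bag⇒↭)
open import Data.List.Relation.Binary.Permutation.Propositional using (_↭_; ↭⇒↭ₛ)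
import Data.List.Relation.Binary.Permutation.Propositional.Properties as ↭
open import Data.List.Relation.Binary.Permutation.Setoid.Properties using (foldr-commMonoid)
import Data.List.Relation.Binary.Subset.DecPropositional as DecSubset
open import Data.List.Relation.Unary.All as All using (All; []; _∷_)
open import Data.List.Relation.Unary.Any using (here; there)
open import Data.List.Relation.Unary.Unique.Propositional using (Unique; []; _∷_)
import Data.List.Relation.Unary.Unique.Propositional.Properties as Unique
import Data.List.Relation.Unary.Unique.DecPropositional.Properties as UniqueDec
open import Data.Nat as ℕ using (ℕ; suc; _∸_; z≤n; s≤s)
import Data.Nat.Properties as ℕ
open import Data.Product using (Σ-syntax; _×_; _,_; proj₁; proj₂)
open import Data.Product.Function.NonDependent.Propositional using (_×-⇔_)
open import Data.Sum using (_⊎_; inj₁; inj₂)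
open import Data.Unit using (⊤; tt)
open import Data.Vec using (Vec; lookup) renaming ([] to []ᵛ; _∷_ to _∷ᵛ_)
open import Data.Vec.Relation.Unary.All as VAll using () renaming ([] to []ᵗ; _∷_ to _∷ᵗ_)
open import Function using (_∘_; flip; id)
open import Function.Bundles using (_⇔_; mk⇔; Equivalence)
open import Induction.WellFounded as WF using (Acc; acc)
open import Level using (0ℓ)
open import Relation.Binary.Definitions using (DecidableEquality)
open import Relation.Binary.PropositionalEquality
  using (_≡_; _≢_; refl; sym; trans; cong; cong₂; subst; subst₂; module ≡-Reasoning)
open import Relation.Binary.Structures using (IsPartialOrder)
open import Relation.Nullary using (¬_; Dec; yes; no)
open import Relation.Nullary.Decidable using (T?; map′; _×-dec_)
open import Relation.Unary using (Pred; Decidable; _≐_)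
import Algebra.Properties.CommutativeSemigroup ℤ.+-commutativeSemigroup as +-CSemigroup
import Algebra.Properties.CommutativeSemigroup ℤ.*-commutativeSemigroup as *-CSemigroup

open import Defs

-- Finite sums

sumOf : {A : Set} → (A → ℤ) → List A → ℤ
sumOf g L = sumℤ (map g L)

module _ {A : Set} where

  sumOf-cong : {g h : A → ℤ} (L : List A) → (∀ {a} → a ∈ L → g a ≡ h a) → sumOf g L ≡ sumOf h L
  sumOf-cong []      e = refl
  sumOf-cong (x ∷ L) e = cong₂ _+_ (e (here refl)) (sumOf-cong L (e ∘ there))

  sumOf-++ : (g : A → ℤ) (xs ys : List A) → sumOf g (xs ++ ys) ≡ sumOf g xs + sumOf g ys
  sumOf-++ g []       ys = sym (ℤ.+-identityˡ _)
  sumOf-++ g (x ∷ xs) ys = trans (cong (_+_ (g x)) (sumOf-++ g xs ys)) (sym (ℤ.+-assoc (g x) _ _))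

  sumOf-const : {g : A → ℤ} (c : ℤ) (L : List A) → (∀ {a} → a ∈ L → g a ≡ c) →
                sumOf g L ≡ + length L * c
  sumOf-const c []      e = sym (ℤ.*-zeroˡ c)
  sumOf-const c (x ∷ L) e = begin
    _                       ≡⟨ cong₂ _+_ (e (here refl)) (sumOf-const c L (e ∘ there)) ⟩
    c + + length L * c      ≡⟨ cong (_+ + length L * c) (sym (ℤ.*-identityˡ c)) ⟩
    1ℤ * c + + length L * c ≡⟨ sym (ℤ.*-distribʳ-+ c 1ℤ (+ length L)) ⟩
    (1ℤ + + length L) * c   ∎
    where open ≡-Reasoning

  sumOf-zero : {g : A → ℤ} (L : List A) → (∀ {a} → a ∈ L → g a ≡ 0ℤ) → sumOf g L ≡ 0ℤ
  sumOf-zero L e = trans (sumOf-const 0ℤ L e) (ℤ.*-zeroʳ (+ length L))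

  sumOf-*ˡ : (c : ℤ) (g : A → ℤ) (L : List A) → sumOf (λ a → c * g a) L ≡ c * sumOf g L
  sumOf-*ˡ c g []      = sym (ℤ.*-zeroʳ c)
  sumOf-*ˡ c g (x ∷ L) =
    trans (cong (_+_ (c * g x)) (sumOf-*ˡ c g L)) (sym (ℤ.*-distribˡ-+ c (g x) _))

  sumOf-*ʳ : (c : ℤ) (g : A → ℤ) (L : List A) → sumOf (λ a → g a * c) L ≡ sumOf g L * c
  sumOf-*ʳ c g []      = sym (ℤ.*-zeroˡ c)
  sumOf-*ʳ c g (x ∷ L) =
    trans (cong (_+_ (g x * c)) (sumOf-*ʳ c g L)) (sym (ℤ.*-distribʳ-+ c (g x) _))

  sumOf-+ : (g h : A → ℤ) (L : List A) → sumOf (λ a → g a + h a) L ≡ sumOf g L + sumOf h L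
  sumOf-+ g h []      = refl
  sumOf-+ g h (x ∷ L) =
    trans (cong (_+_ (g x + h x)) (sumOf-+ g h L)) (+-CSemigroup.interchange (g x) (h x) _ _)

  sumOf-neg : (g : A → ℤ) (L : List A) → sumOf (λ a → - g a) L ≡ - sumOf g L
  sumOf-neg g []      = refl
  sumOf-neg g (x ∷ L) =
    trans (cong (_+_ (- g x)) (sumOf-neg g L)) (sym (ℤ.neg-distrib-+ (g x) _))

  sumOf-- : (g h : A → ℤ) (L : List A) → sumOf (λ a → g a - h a) L ≡ sumOf g L - sumOf h L
  sumOf-- g h L = trans (sumOf-+ g (-_ ∘ h) L) (cong (_+_ (sumOf g L)) (sumOf-neg h L))

  sumOf-single : (g : A → ℤ) {L : List A} {x : A} → Unique L → x ∈ L →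
                 (∀ {y} → y ∈ L → y ≢ x → g y ≡ 0ℤ) → sumOf g L ≡ g x
  sumOf-single g (x∉L ∷ _) (here refl) e =
    trans (cong (_+_ (g _)) (sumOf-zero _ λ y∈L → e (there y∈L) (All.lookup x∉L y∈L ∘ sym)))
          (ℤ.+-identityʳ _)
  sumOf-single g (z∉L ∷ u) (there x∈L) e =
    trans (cong₂ _+_ (e (here refl) (All.lookup z∉L x∈L)) (sumOf-single g u x∈L (e ∘ there)))
          (ℤ.+-identityˡ _)

  sumOf-filter : {Q : Pred A 0ℓ} (Q? : Decidable Q) (g : A → ℤ) (L : List A) →
                 (∀ {a} → a ∈ L → ¬ Q a → g a ≡ 0ℤ) → sumOf g (filter Q? L) ≡ sumOf g L
  sumOf-filter Q? g []      e = refl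
  sumOf-filter Q? g (x ∷ L) e with Q? x
  ... | yes _ = cong (_+_ (g x)) (sumOf-filter Q? g L (e ∘ there))
  ... | no ¬q = trans (sumOf-filter Q? g L (e ∘ there))
                      (sym (trans (cong (_+ sumOf g L) (e (here refl) ¬q)) (ℤ.+-identityˡ _)))

  sumOf-↭ : (g : A → ℤ) {L L' : List A} → L ↭ L' → sumOf g L ≡ sumOf g L'
  sumOf-↭ g p = foldr-commMonoid M.setoid M.isCommutativeMonoid (↭⇒↭ₛ (↭.map⁺ g p))
    where module M = CommutativeMonoid ℤ.+-0-commutativeMonoid

sumOf-map : {A B : Set} (g : B → ℤ) (k : A → B) (L : List A) → sumOf g (map k L) ≡ sumOf (g ∘ k) L
sumOf-map g k []      = refl
sumOf-map g k (x ∷ L) = cong (_+_ (g (k x))) (sumOf-map g k L)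

module _ {A B : Set} (_≟_ : DecidableEquality B) (h : A → B) where

  fibre : B → List A → List A
  fibre y = filter (λ a → h a ≟ y)

  sumOf-fibres : (g : A → ℤ) {LB : List B} → Unique LB → (LA : List A) →
                 (∀ {a} → a ∈ LA → h a ∈ LB) → sumOf (λ y → sumOf g (fibre y LA)) LB ≡ sumOf g LA
  sumOf-fibres g {LB} u []       _   = sumOf-zero LB (λ _ → refl)
  sumOf-fibres g {LB} u (x ∷ LA) cov = begin
    sumOf (λ y → sumOf g (fibre y (x ∷ LA))) LB          ≡⟨ sumOf-cong LB (λ _ → split _) ⟩
    sumOf (λ y → hit y + sumOf g (fibre y LA)) LB        ≡⟨ sumOf-+ hit _ LB ⟩
    sumOf hit LB + sumOf (λ y → sumOf g (fibre y LA)) LB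
      ≡⟨ cong₂ _+_ hit-total (sumOf-fibres g u LA (cov ∘ there)) ⟩
    g x + sumOf g LA                                     ∎
    where
    open ≡-Reasoning
    hit : B → ℤ
    hit y with h x ≟ y
    ... | yes _ = g x
    ... | no _  = 0ℤ
    split : ∀ y → sumOf g (fibre y (x ∷ LA)) ≡ hit y + sumOf g (fibre y LA)
    split y with h x ≟ y
    ... | yes _ = refl
    ... | no _  = sym (ℤ.+-identityˡ _)
    miss : ∀ {y} → y ∈ LB → y ≢ h x → hit y ≡ 0ℤ
    miss {y} _ y≢hx with h x ≟ y
    ... | yes hx≡y = ⊥-elim (y≢hx (sym hx≡y))
    ... | no _     = refl
    hit-self : hit (h x) ≡ g x
    hit-self with h x ≟ h x
    ... | yes _    = refl
    ... | no hx≢hx = ⊥-elim (hx≢hx refl)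
    hit-total : sumOf hit LB ≡ g x
    hit-total = trans (sumOf-single hit u (cov (here refl)) miss) hit-self

^-exchange : (t : ℤ) {σ m n : ℕ} → σ ℕ.≤ m → σ ℕ.≤ n →
             t ^ n * t ^ (m ∸ σ) ≡ t ^ m * t ^ (n ∸ σ)
^-exchange t {σ} {m} {n} σ≤m σ≤n = begin
  t ^ n * t ^ (m ∸ σ) ≡⟨ sym (ℤ.^-distribˡ-+-* t n (m ∸ σ)) ⟩
  t ^ (n ℕ.+ (m ∸ σ)) ≡⟨ cong (t ^_) (sym (ℕ.+-∸-assoc n σ≤m)) ⟩
  t ^ (n ℕ.+ m ∸ σ)   ≡⟨ cong (λ e → t ^ (e ∸ σ)) (ℕ.+-comm n m) ⟩
  t ^ (m ℕ.+ n ∸ σ)   ≡⟨ cong (t ^_) (ℕ.+-∸-assoc m σ≤n) ⟩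
  t ^ (m ℕ.+ (n ∸ σ)) ≡⟨ ℤ.^-distribˡ-+-* t m (n ∸ σ) ⟩
  t ^ m * t ^ (n ∸ σ) ∎
  where open ≡-Reasoning

-- Enumerations

module _ {A : Set} {P : Pred A 0ℓ} where

  enum-sound : {L : List A} → Enumerates L P → ∀ {a} → a ∈ L → P a
  enum-sound (_ , e) = Equivalence.to (e _)

  enum-complete : {L : List A} → Enumerates L P → ∀ {a} → P a → a ∈ L
  enum-complete (_ , e) = Equivalence.from (e _)

  enum-≐ : {Q : Pred A 0ℓ} {L : List A} → Enumerates L P → P ≐ Q → Enumerates L Q
  enum-≐ E@(u , _) (P⊆Q , Q⊆P) = u , λ _ → mk⇔ (P⊆Q ∘ enum-sound E) (enum-complete E ∘ Q⊆P)

  enum-↭ : {L L' : List A} → Enumerates L P → Enumerates L' P → L ↭ L'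
  enum-↭ E@(u , _) E'@(u' , _) = ∼bag⇒↭ (unique∧set⇒bag u u'
    (mk⇔ (enum-complete E' ∘ enum-sound E) (enum-complete E ∘ enum-sound E')))

  sumOf-enum : (g : A → ℤ) {L L' : List A} → Enumerates L P → Enumerates L' P →
               sumOf g L ≡ sumOf g L'
  sumOf-enum g E E' = sumOf-↭ g (enum-↭ E E')

  length-enum : {L L' : List A} → Enumerates L P → Enumerates L' P → length L ≡ length L'
  length-enum E E' = ↭.↭-length (enum-↭ E E')

  SumsTo-intro : {g : A → ℤ} {z : ℤ} {L : List A} → Enumerates L P → sumOf g L ≡ z → SumsTo P g z
  SumsTo-intro {g} E eq L' E' = trans (sumOf-enum g E' E) eq

  enum-filter : {Q : Pred A 0ℓ} {L : List A} → Enumerates L P → (Q? : Decidable Q) →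
                Enumerates (filter Q? L) (λ a → P a × Q a)
  enum-filter E@(u , _) Q? = Unique.filter⁺ Q? u , λ _ → mk⇔
    (λ a∈ → let a∈L , q = ∈-filter⁻ Q? a∈ in enum-sound E a∈L , q)
    (λ (p , q) → ∈-filter⁺ Q? (enum-complete E p) q)

  enum-∷ : {L : List A} {a : A} → Enumerates L P → ¬ P a →
           Enumerates (a ∷ L) (λ b → b ≡ a ⊎ P b)
  enum-∷ E@(u , _) ¬pa =
    All.tabulate (λ b∈L a≡b → ¬pa (subst P (sym a≡b) (enum-sound E b∈L))) ∷ u , λ _ → mk⇔
      (λ { (here b≡a) → inj₁ b≡a ; (there b∈L) → inj₂ (enum-sound E b∈L) })
      (λ { (inj₁ b≡a) → here b≡a ; (inj₂ pb) → there (enum-complete E pb) })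

  enum-deduplicate : DecidableEquality A → (C : List A) → (∀ {a} → P a → a ∈ C) → Decidable P →
                     Σ[ L ∈ List A ] Enumerates L P
  enum-deduplicate _≟_ C covers P? =
    deduplicate _≟_ (filter P? C) , UniqueDec.deduplicate-! _≟_ _ , λ _ → mk⇔
      (λ a∈ → proj₂ (∈-filter⁻ P? {xs = C} (∈-deduplicate⁻ _≟_ (filter P? C) a∈)))
      (λ p → ∈-deduplicate⁺ _≟_ (∈-filter⁺ P? (covers p) p))

allFin-enum : (N : ℕ) → Enumerates (allFin N) (λ _ → ⊤)
allFin-enum N = Unique.allFin⁺ N , λ a → mk⇔ (λ _ → tt) (λ _ → ∈-allFin a)

-- Möbius functions of finite posets

module Poset {N : ℕ} (P : FinPoset N) where
  open FinPoset P
  open IsPartialOrder isPartialOrder public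
    using () renaming (refl to ≤-refl; trans to ≤-trans; antisym to ≤-antisym)

  <-trans : ∀ {x y z} → x < y → y < z → x < z
  <-trans (x≤y , x≢y) (y≤z , _) = ≤-trans x≤y y≤z , λ { refl → x≢y (≤-antisym x≤y y≤z) }

  ↓_ : Fin N → List (Fin N)
  ↓ x = filter (_≤? x) (allFin N)

  ↓-enum : ∀ x → Enumerates (↓ x) (_≤P x)
  ↓-enum x = enum-≐ (enum-filter (allFin-enum N) (_≤? x)) (proj₂ , (tt ,_))

  mobius-unique : {μ ν : Fin N → ℤ} → IsMobius _≤P_ bot μ → IsMobius _≤P_ bot ν →
                  ∀ x → μ x ≡ ν x
  mobius-unique {μ} {ν} M M' = WF.All.wfRec (po-wellFounded isPartialOrder) 0ℓ _ step
    where
    sums-agree : ∀ x → sumOf μ (↓ x) ≡ sumOf ν (↓ x)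
    sums-agree x with x Fin.≟ bot
    ... | yes x≡bot = trans (proj₁ (M x) x≡bot _ (↓-enum x)) (sym (proj₁ (M' x) x≡bot _ (↓-enum x)))
    ... | no  x≢bot = trans (proj₂ (M x) x≢bot _ (↓-enum x)) (sym (proj₂ (M' x) x≢bot _ (↓-enum x)))
    step : ∀ x → (∀ {y} → y < x → μ y ≡ ν y) → μ x ≡ ν x
    step x below = ℤ.i-j≡0⇒i≡j (μ x) (ν x) (begin
      μ x - ν x
        ≡⟨ sym (sumOf-single (λ y → μ y - ν y) (proj₁ (↓-enum x)) x∈↓x differ) ⟩
      sumOf (λ y → μ y - ν y) (↓ x)
        ≡⟨ sumOf-- μ ν (↓ x) ⟩
      sumOf μ (↓ x) - sumOf ν (↓ x)
        ≡⟨ cong (_- sumOf ν (↓ x)) (sums-agree x) ⟩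
      sumOf ν (↓ x) - sumOf ν (↓ x)
        ≡⟨ ℤ.+-inverseʳ (sumOf ν (↓ x)) ⟩
      0ℤ ∎)
      where
      open ≡-Reasoning
      x∈↓x = enum-complete (↓-enum x) ≤-refl
      differ : ∀ {y} → y ∈ ↓ x → y ≢ x → μ y - ν y ≡ 0ℤ
      differ {y} y∈ y≢x =
        trans (cong (_- ν y) (below (enum-sound (↓-enum x) y∈ , y≢x))) (ℤ.+-inverseʳ (ν y))

-- Rooted trees and their products

module RootedTrees {N : ℕ} (P : FinPoset N) where
  open FinPoset P
  open Poset P

  private variable
    n  : ℕ
    Ss : Vec (Subset N) n

  sat-∷⁻ : ∀ {S x y ys} → T (satFrom S x (y ∷ ys)) → x ⋖ y × T (lookup S y) × T (satFrom S y ys)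
  sat-∷⁻ {S} {x} {y} p with x ⋖? y
  ... | yes x⋖y = x⋖y , Equivalence.to (T-∧ {lookup S y}) p
  ... | no  _   = ⊥-elim p

  sat-∷⁺ : ∀ {S x y ys} → x ⋖ y → T (lookup S y) → T (satFrom S y ys) → T (satFrom S x (y ∷ ys))
  sat-∷⁺ {S} {x} {y} x⋖y y∈S p with x ⋖? y
  ... | yes _   = Equivalence.from (T-∧ {lookup S y}) (y∈S , p)
  ... | no  x⋪y = x⋪y x⋖y

  sat⇒above : ∀ {S x} cs → T (satFrom S x cs) → All (x <_) cs
  sat⇒above []       _ = []
  sat⇒above (y ∷ ys) p with (x<y , _) , _ , p' ← sat-∷⁻ {ys = ys} p =
    x<y ∷ All.map (<-trans x<y) (sat⇒above ys p')

  RT-≡ : ∀ {S} {a b : RT S} → proj₁ a ≡ proj₁ b → a ≡ b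
  RT-≡ {S} {cs , p} {.cs , q} refl = cong (cs ,_) (T-irrelevant p q)

  _≟RT_ : ∀ {S} → DecidableEquality (RT S)
  a ≟RT b = map′ RT-≡ (cong proj₁) (≡-dec Fin._≟_ (proj₁ a) (proj₁ b))

  _≤RT?_ : ∀ {S} (a b : RT S) → Dec (a ≤RT b)
  a ≤RT? b = DecSubset._⊆?_ Fin._≟_ (chain a) (chain b)

  -- Saturated chains ascend strictly, so recursion on the noetherian strict order of P lists a
  -- superset of them.
  mutual
    ascendingFrom : (x : Fin N) → Acc (flip _<_) x → List (List (Fin N))
    ascendingFrom x (acc above) = [] ∷ concatMap (λ y → stepUp x y (x <? y) above) (allFin N)

    stepUp : ∀ x y → Dec (x < y) → (∀ {z} → x < z → Acc (flip _<_) z) → List (List (Fin N))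
    stepUp x y (yes x<y) above = map (y ∷_) (ascendingFrom y (above x<y))
    stepUp x y (no _)    above = []

  ascendingFrom-complete : ∀ {S x} (ac : Acc (flip _<_) x) cs → T (satFrom S x cs) →
                           cs ∈ ascendingFrom x ac
  ascendingFrom-complete (acc above) []       _ = here refl
  ascendingFrom-complete {S} {x} (acc above) (y ∷ ys) p with x⋖y , _ , p' ← sat-∷⁻ {S} {ys = ys} p =
    there (∈-concat⁺′ (reached (x <? y)) (∈-map⁺ _ (∈-allFin y)))
    where
    reached : (d : Dec (x < y)) → y ∷ ys ∈ stepUp x y d above
    reached (yes x<y) = ∈-map⁺ (y ∷_) (ascendingFrom-complete (above x<y) ys p')
    reached (no x≮y)  = ⊥-elim (x≮y (proj₁ x⋖y))

  asRT : ∀ {S} cs → Dec (T (satFrom S bot cs)) → List (RT S)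
  asRT cs (yes p) = (cs , p) ∷ []
  asRT cs (no _)  = []

  allRT : ∀ S → Σ[ L ∈ List (RT S) ] Enumerates L (λ _ → ⊤)
  allRT S = enum-deduplicate _≟RT_ cover (λ {a} _ → covered a) (λ _ → yes tt)
    where
    ac = po-noetherian isPartialOrder bot
    cover = concatMap (λ cs → asRT cs (T? (satFrom S bot cs))) (ascendingFrom bot ac)
    realised : ∀ {cs} (p : T (satFrom S bot cs)) d → (cs , p) ∈ asRT cs d
    realised p (yes q) = here (RT-≡ refl)
    realised p (no ¬p) = ⊥-elim (¬p p)
    covered : (a : RT S) → a ∈ cover
    covered (cs , p) = ∈-concat⁺′ (realised p _) (∈-map⁺ _ (ascendingFrom-complete ac cs p))

  root≤RT : ∀ {S} (a : RT S) → root S ≤RT a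
  root≤RT _ (here refl) = here refl

  ≤RT-root : ∀ {S} (a : RT S) → a ≤RT root S → a ≡ root S
  ≤RT-root ([] , _) _ = refl
  ≤RT-root {S} (w ∷ ws , p) a≤root with a≤root (there (here refl))
  ... | here w≡bot = ⊥-elim (proj₂ (proj₁ (proj₁ (sat-∷⁻ {S} {ys = ws} p))) (sym w≡bot))
  ... | there ()

  head-≤RT : ∀ {S w ws h hs} (p : T (satFrom S bot (w ∷ ws))) (q : T (satFrom S bot (h ∷ hs))) →
             _≤RT_ {S} (w ∷ ws , p) (h ∷ hs , q) → w ≡ h
  head-≤RT {S} {w} {ws} {h} {hs} p q a≤b with a≤b (there (here refl))
  ... | here w≡bot         = ⊥-elim (proj₂ (proj₁ bot⋖w) (sym w≡bot))
    where bot⋖w = proj₁ (sat-∷⁻ {S} {ys = ws} p)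
  ... | there (here w≡h)   = w≡h
  ... | there (there w∈hs) =
    ⊥-elim (proj₂ bot⋖w h (proj₁ bot⋖h) (All.lookup (sat⇒above hs q') w∈hs))
    where
    bot⋖w = proj₁ (sat-∷⁻ {S} {ys = ws} p)
    bot⋖h = proj₁ (sat-∷⁻ {S} {ys = hs} q)
    q'    = proj₂ (proj₂ (sat-∷⁻ {S} {ys = hs} q))

  depth : ∀ {S} → RT S → ℕ
  depth = length ∘ proj₁

  depth≤1? : ∀ {S} (a : RT S) → Dec (depth a ℕ.≤ 1)
  depth≤1? a = depth a ℕ.≤? 1

  firstStep : ∀ {S} w ws → T (satFrom S bot (w ∷ ws)) → RT S
  firstStep {S} w ws p with bot⋖w , w∈S , _ ← sat-∷⁻ {S} {ys = ws} p =
    w ∷ [] , sat-∷⁺ {S} {ys = []} bot⋖w w∈S tt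

  firstStep≤RT : ∀ {S} w ws p → firstStep {S} w ws p ≤RT (w ∷ ws , p)
  firstStep≤RT w ws p (here e)         = here e
  firstStep≤RT w ws p (there (here e)) = there (here e)

  atom⇒depth≡1 : ∀ {S} (a : RT S) → IsAtomRT a → depth a ≡ 1
  atom⇒depth≡1 ([] , _)     ((_ , root≢root) , _) = ⊥-elim (root≢root refl)
  atom⇒depth≡1 (_ ∷ [] , _) _                     = refl
  atom⇒depth≡1 {S} (w ∷ ws@(_ ∷ _) , p) (_ , noneBetween) =
    ⊥-elim (noneBetween step (root≤RT step , λ ()) (firstStep≤RT {S} w ws p , λ ()))
    where step = firstStep {S} w ws p

  depth≡1⇒atom : ∀ {S} (a : RT S) → depth a ≡ 1 → IsAtomRT a
  depth≡1⇒atom {S} a@(w ∷ [] , q) _ = (root≤RT a , λ ()) , noneBetween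
    where
    noneBetween : (z : RT S) → root S <RT z → ¬ (z <RT a)
    noneBetween ([] , _)          (_ , root≢z) _           = root≢z refl
    noneBetween (y ∷ [] , p)      _            (z≤a , z≢a) =
      z≢a (RT-≡ (cong (_∷ []) (head-≤RT {S} p q z≤a)))
    noneBetween (y ∷ y' ∷ ys , p) _            (z≤a , _) with z≤a (there (there (here refl)))
    ... | here y'≡bot       = proj₂ bot<y' (sym y'≡bot)
      where bot<y' = All.lookup (sat⇒above {S} (y ∷ y' ∷ ys) p) (there (here refl))
    ... | there (here y'≡w) = proj₂ y<y' (trans (head-≤RT {S} p q z≤a) (sym y'≡w))
      where
      p' = proj₂ (proj₂ (sat-∷⁻ {S} {ys = y' ∷ ys} p))
      y<y' = All.lookup (sat⇒above {S} (y' ∷ ys) p') (here refl)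
    ... | there (there ())

  atomic⇔depth≤1 : ∀ {S} (a : RT S) → ((a ≡ root S) ⊎ IsAtomRT a) ⇔ depth a ℕ.≤ 1
  atomic⇔depth≤1 {S} a = mk⇔ to (from a)
    where
    to : (a ≡ root S) ⊎ IsAtomRT a → depth a ℕ.≤ 1
    to (inj₁ refl)   = z≤n
    to (inj₂ atomic) = ℕ.≤-reflexive (atom⇒depth≡1 a atomic)
    from : (b : RT S) → depth b ℕ.≤ 1 → (b ≡ root S) ⊎ IsAtomRT b
    from ([] , _)        _        = inj₁ refl
    from b@(_ ∷ [] , _)  _        = inj₂ (depth≡1⇒atom b refl)
    from (_ ∷ _ ∷ _ , _) (s≤s ())

  shallowBelow : ∀ {S} → RT S → List (RT S)
  shallowBelow ([] , _)     = root _ ∷ []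
  shallowBelow (w ∷ ws , p) = root _ ∷ firstStep w ws p ∷ []

  shallowBelow-enum : ∀ {S} (a : RT S) →
                      Enumerates (shallowBelow a) (λ y → y ≤RT a × depth y ℕ.≤ 1)
  shallowBelow-enum a@([] , _) = [] ∷ [] , λ y → mk⇔
    (λ { (here refl) → root≤RT a , z≤n })
    (λ (y≤a , _) → here (≤RT-root y y≤a))
  shallowBelow-enum {S} a@(w ∷ ws , p) = ((λ ()) ∷ []) ∷ [] ∷ [] , λ y → mk⇔
    (λ { (here refl) → root≤RT a , z≤n ; (there (here refl)) → firstStep≤RT w ws p , s≤s z≤n })
    (below y)
    where
    below : (y : RT S) → y ≤RT a × depth y ℕ.≤ 1 → y ∈ shallowBelow a
    below ([] , _)        _             = here refl
    below (v ∷ [] , p')   (y≤a , _)     =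
      there (here (RT-≡ (cong (_∷ []) (head-≤RT {S} p' p y≤a))))
    below (_ ∷ _ ∷ _ , _) (_ , s≤s ())

  -- The Möbius function of RT_S, with its value 1 at the root replaced by c.
  weight : ∀ {S} → ℤ → RT S → ℤ
  weight c ([] , _)        = c
  weight c (_ ∷ [] , _)    = -1ℤ
  weight c (_ ∷ _ ∷ _ , _) = 0ℤ

  weight-deep : ∀ {S} (c : ℤ) (a : RT S) → ¬ depth a ℕ.≤ 1 → weight c a ≡ 0ℤ
  weight-deep c ([] , _)        a≰1 = ⊥-elim (a≰1 z≤n)
  weight-deep c (_ ∷ [] , _)    a≰1 = ⊥-elim (a≰1 (s≤s z≤n))
  weight-deep c (_ ∷ _ ∷ _ , _) _   = refl

  weight-atom : ∀ {S} (c : ℤ) (a : RT S) → IsAtomRT a → weight c a ≡ -1ℤ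
  weight-atom c a atom with a | atom⇒depth≡1 a atom
  ... | _ ∷ [] , _ | _ = refl

  rootIndicator : ∀ {S} → RT S → ℤ
  rootIndicator ([] , _)    = 1ℤ
  rootIndicator (_ ∷ _ , _) = 0ℤ

  sumOf-weight-below : ∀ {S} (a : RT S) {D : List (RT S)} → Enumerates D (_≤RT a) →
                       sumOf (weight 1ℤ) D ≡ rootIndicator a
  sumOf-weight-below a {D} E = begin
    sumOf (weight 1ℤ) D
      ≡⟨ sym (sumOf-filter depth≤1? _ D (λ {b} _ → weight-deep 1ℤ b)) ⟩
    sumOf (weight 1ℤ) (filter depth≤1? D)
      ≡⟨ sumOf-enum _ (enum-filter E depth≤1?) (shallowBelow-enum a) ⟩
    sumOf (weight 1ℤ) (shallowBelow a)
      ≡⟨ total a ⟩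
    rootIndicator a ∎
    where
    open ≡-Reasoning
    total : ∀ b → sumOf (weight 1ℤ) (shallowBelow b) ≡ rootIndicator b
    total ([] , _)    = refl
    total (_ ∷ _ , _) = refl

  sumOf-weight : ∀ {S} (c : ℤ) {k : ℕ} → Card (IsAtomRT {S}) k →
                 sumOf (weight c) (proj₁ (allRT S)) ≡ c - + k
  sumOf-weight {S} c {k} (As , E , |As|≡k) = begin
    sumOf (weight c) all
      ≡⟨ sym (sumOf-filter depth≤1? _ all (λ {b} _ → weight-deep c b)) ⟩
    sumOf (weight c) (filter depth≤1? all)
      ≡⟨ sumOf-enum _ (enum-filter (proj₂ (allRT S)) depth≤1?) root∷As-enum ⟩
    c + sumOf (weight c) As
      ≡⟨ cong (_+_ c) (sumOf-const -1ℤ As (weight-atom c _ ∘ enum-sound E)) ⟩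
    c + + length As * -1ℤ
      ≡⟨ cong (λ l → c + + l * -1ℤ) |As|≡k ⟩
    c + + k * -1ℤ
      ≡⟨ cong (_+_ c) (trans (ℤ.*-comm (+ k) -1ℤ) (ℤ.-1*i≡-i (+ k))) ⟩
    c - + k ∎
    where
    open ≡-Reasoning
    all = proj₁ (allRT S)
    root-not-atom : ¬ IsAtomRT (root S)
    root-not-atom ((_ , root≢root) , _) = root≢root refl
    root∷As-enum : Enumerates (root S ∷ As) (λ b → ⊤ × depth b ℕ.≤ 1)
    root∷As-enum = enum-≐ (enum-∷ E root-not-atom)
      ( (λ {b} atomic → tt , Equivalence.to (atomic⇔depth≤1 b) atomic)
      , (λ {b} (_ , b≤1) → Equivalence.from (atomic⇔depth≤1 b) b≤1))

  Candidates : Vec (Subset N) n → Set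
  Candidates = VAll.All (λ S → List (RT S))

  cartesian : Candidates Ss → List (Tup Ss)
  cartesian []ᵗ       = []ᵗ ∷ []
  cartesian (L ∷ᵗ Ls) = cartesianProductWith _∷ᵗ_ L (cartesian Ls)

  _∈ᶜ_ : Tup Ss → Candidates Ss → Set
  []ᵗ       ∈ᶜ []ᵗ       = ⊤
  (a ∷ᵗ as) ∈ᶜ (L ∷ᵗ Ls) = a ∈ L × as ∈ᶜ Ls

  AllUnique : Candidates Ss → Set
  AllUnique []ᵗ       = ⊤
  AllUnique (L ∷ᵗ Ls) = Unique L × AllUnique Ls

  ∷ᵗ-injective : ∀ {S} {a b : RT S} {as bs : Tup Ss} →
                 _≡_ {A = Tup (S ∷ᵛ Ss)} (a ∷ᵗ as) (b ∷ᵗ bs) → a ≡ b × as ≡ bs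
  ∷ᵗ-injective refl = refl , refl

  cartesian-unique : (Ls : Candidates Ss) → AllUnique Ls → Unique (cartesian Ls)
  cartesian-unique []ᵗ       _        = [] ∷ []
  cartesian-unique (L ∷ᵗ Ls) (u , us) =
    Unique.cartesianProductWith⁺ _∷ᵗ_ ∷ᵗ-injective u (cartesian-unique Ls us)

  ∈-cartesian⁻ : (Ls : Candidates Ss) (t : Tup Ss) → t ∈ cartesian Ls → t ∈ᶜ Ls
  ∈-cartesian⁻ []ᵗ       []ᵗ       _  = tt
  ∈-cartesian⁻ (L ∷ᵗ Ls) (a ∷ᵗ as) t∈
    with b , bs , b∈L , bs∈ , eq ← ∈-cartesianProductWith⁻ _∷ᵗ_ L (cartesian Ls) t∈
    with refl , refl ← ∷ᵗ-injective eq = b∈L , ∈-cartesian⁻ Ls bs bs∈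

  ∈-cartesian⁺ : (Ls : Candidates Ss) (t : Tup Ss) → t ∈ᶜ Ls → t ∈ cartesian Ls
  ∈-cartesian⁺ []ᵗ       []ᵗ       _           = here refl
  ∈-cartesian⁺ (L ∷ᵗ Ls) (a ∷ᵗ as) (a∈L , as∈) =
    ∈-cartesianProductWith⁺ _∷ᵗ_ a∈L (∈-cartesian⁺ Ls as as∈)

  cartesian-enum : (Ls : Candidates Ss) → AllUnique Ls → Enumerates (cartesian Ls) (_∈ᶜ Ls)
  cartesian-enum Ls u = cartesian-unique Ls u , λ t → mk⇔ (∈-cartesian⁻ Ls t) (∈-cartesian⁺ Ls t)

  ∏ : (∀ {S} → RT S → ℤ) → Tup Ss → ℤ
  ∏ g []ᵗ       = 1ℤ
  ∏ g (a ∷ᵗ as) = g a * ∏ g as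

  ∏sumOf : (∀ {S} → RT S → ℤ) → Candidates Ss → ℤ
  ∏sumOf g []ᵗ       = 1ℤ
  ∏sumOf g (L ∷ᵗ Ls) = sumOf g L * ∏sumOf g Ls

  sumOf-cartesian : (g : ∀ {S} → RT S → ℤ) (Ls : Candidates Ss) →
                    sumOf (∏ g) (cartesian Ls) ≡ ∏sumOf g Ls
  sumOf-cartesian g []ᵗ       = refl
  sumOf-cartesian g (L ∷ᵗ Ls) =
    trans (distrib L (cartesian Ls)) (cong (sumOf g L *_) (sumOf-cartesian g Ls))
    where
    open ≡-Reasoning
    distrib : ∀ {S} (L : List (RT S)) (R : List (Tup Ss)) →
              sumOf (∏ g) (cartesianProductWith _∷ᵗ_ L R) ≡ sumOf g L * sumOf (∏ g) R
    distrib []      R = sym (ℤ.*-zeroˡ (sumOf (∏ g) R))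
    distrib (a ∷ L) R = begin
      sumOf (∏ g) (map (a ∷ᵗ_) R ++ cartesianProductWith _∷ᵗ_ L R)
        ≡⟨ sumOf-++ (∏ g) (map (a ∷ᵗ_) R) _ ⟩
      sumOf (∏ g) (map (a ∷ᵗ_) R) + sumOf (∏ g) (cartesianProductWith _∷ᵗ_ L R)
        ≡⟨ cong₂ _+_ (trans (sumOf-map (∏ g) (a ∷ᵗ_) R) (sumOf-*ˡ (g a) (∏ g) R)) (distrib L R) ⟩
      g a * sumOf (∏ g) R + sumOf g L * sumOf (∏ g) R
        ≡⟨ sym (ℤ.*-distribʳ-+ (sumOf (∏ g) R) (g a) (sumOf g L)) ⟩
      (g a + sumOf g L) * sumOf (∏ g) R ∎

  ∏-minT : (Ss : Vec (Subset N) n) (g : ∀ {S} → RT S → ℤ) → (∀ {S} → g (root S) ≡ 1ℤ) →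
           ∏ g (minT Ss) ≡ 1ℤ
  ∏-minT []ᵛ       g g-root = refl
  ∏-minT (S ∷ᵛ Ss) g g-root = trans (cong₂ _*_ g-root (∏-minT Ss g g-root)) (ℤ.*-identityˡ 1ℤ)

  allCandidates : (Ss : Vec (Subset N) n) → Candidates Ss
  allCandidates []ᵛ       = []ᵗ
  allCandidates (S ∷ᵛ Ss) = proj₁ (allRT S) ∷ᵗ allCandidates Ss

  allTup : (Ss : Vec (Subset N) n) → List (Tup Ss)
  allTup Ss = cartesian (allCandidates Ss)

  allTup-enum : (Ss : Vec (Subset N) n) → Enumerates (allTup Ss) (λ _ → ⊤)
  allTup-enum Ss =
    enum-≐ (cartesian-enum (allCandidates Ss) (unique Ss)) ((λ _ → tt) , λ {t} _ → everywhere t)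
    where
    unique : ∀ {n} (Ss : Vec (Subset N) n) → AllUnique (allCandidates Ss)
    unique []ᵛ       = tt
    unique (S ∷ᵛ Ss) = proj₁ (proj₂ (allRT S)) , unique Ss
    everywhere : ∀ {n} {Ss : Vec (Subset N) n} (t : Tup Ss) → t ∈ᶜ allCandidates Ss
    everywhere []ᵗ                     = tt
    everywhere {Ss = S ∷ᵛ _} (a ∷ᵗ as) = enum-complete (proj₂ (allRT S)) tt , everywhere as

  ∏sumOf-weight : (Ss : Vec (Subset N) n) (c : ℤ) (k : Fin n → ℕ) →
                  ((i : Fin n) → Card (IsAtomRT {lookup Ss i}) (k i)) →
                  ∏sumOf (weight c) (allCandidates Ss) ≡ prodℤ (map (λ i → c - + k i) (allFin n))
  ∏sumOf-weight []ᵛ               c k atoms = refl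
  ∏sumOf-weight {suc n} (S ∷ᵛ Ss) c k atoms = begin
    sumOf (weight c) (proj₁ (allRT S)) * ∏sumOf (weight c) (allCandidates Ss)
      ≡⟨ cong₂ _*_ (sumOf-weight c (atoms zero)) (∏sumOf-weight Ss c (k ∘ suc) (atoms ∘ suc)) ⟩
    (c - + k zero) * prodℤ (map (λ i → c - + k (suc i)) (allFin n))
      ≡⟨ cong (λ l → (c - + k zero) * prodℤ l)
              (trans (map-tabulate id (λ i → c - + k (suc i)))
                     (sym (map-tabulate suc (λ i → c - + k i)))) ⟩
    prodℤ (map (λ i → c - + k i) (allFin (suc n))) ∎
    where open ≡-Reasoning

  belowRT-enum : ∀ {S} (a : RT S) → Enumerates (filter (_≤RT? a) (proj₁ (allRT S))) (_≤RT a)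
  belowRT-enum {S} a = enum-≐ (enum-filter (proj₂ (allRT S)) (_≤RT? a)) (proj₂ , (tt ,_))

  belowCandidates : Tup Ss → Candidates Ss
  belowCandidates []ᵗ                     = []ᵗ
  belowCandidates {Ss = S ∷ᵛ _} (a ∷ᵗ as) =
    filter (_≤RT? a) (proj₁ (allRT S)) ∷ᵗ belowCandidates as

  belowTup-enum : (t : Tup Ss) → Enumerates (cartesian (belowCandidates t)) (_≤T t)
  belowTup-enum t = enum-≐ (cartesian-enum (belowCandidates t) (unique t))
                           ((λ {s} → sound t s) , λ {s} → complete t s)
    where
    unique : ∀ {n} {Ss : Vec (Subset N) n} (t : Tup Ss) → AllUnique (belowCandidates t)
    unique []ᵗ       = tt
    unique (a ∷ᵗ as) = proj₁ (belowRT-enum a) , unique as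
    sound : ∀ {n} {Ss : Vec (Subset N) n} (t s : Tup Ss) → s ∈ᶜ belowCandidates t → s ≤T t
    sound []ᵗ       []ᵗ       _          = tt
    sound (a ∷ᵗ as) (b ∷ᵗ bs) (b∈ , bs∈) = enum-sound (belowRT-enum a) b∈ , sound as bs bs∈
    complete : ∀ {n} {Ss : Vec (Subset N) n} (t s : Tup Ss) → s ≤T t → s ∈ᶜ belowCandidates t
    complete []ᵗ       []ᵗ       _             = tt
    complete (a ∷ᵗ as) (b ∷ᵗ bs) (b≤a , bs≤as) =
      enum-complete (belowRT-enum a) b≤a , complete as bs bs≤as

  AllZero⇒≡minT : (t : Tup Ss) → AllZero t → t ≡ minT Ss
  AllZero⇒≡minT []ᵗ       _              = refl
  AllZero⇒≡minT (a ∷ᵗ as) (refl , zeros) = cong (root _ ∷ᵗ_) (AllZero⇒≡minT as zeros)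

  ∏rootIndicator-≢minT : (t : Tup Ss) → t ≢ minT Ss → ∏ rootIndicator t ≡ 0ℤ
  ∏rootIndicator-≢minT []ᵗ                  t≢min = ⊥-elim (t≢min refl)
  ∏rootIndicator-≢minT (([] , _) ∷ᵗ as)    t≢min =
    trans (ℤ.*-identityˡ _) (∏rootIndicator-≢minT as (t≢min ∘ cong (root _ ∷ᵗ_)))
  ∏rootIndicator-≢minT ((_ ∷ _ , _) ∷ᵗ as) _     = refl

  μᵗ : Tup Ss → ℤ
  μᵗ = ∏ (weight 1ℤ)

  μᵗ-isMobius : (Ss : Vec (Subset N) n) → IsMobius _≤T_ (minT Ss) (μᵗ {Ss = Ss})
  μᵗ-isMobius Ss t =
      (λ { refl → SumsTo-intro E (trans below-sum (∏-minT Ss rootIndicator refl)) })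
    , (λ t≢min → SumsTo-intro E (trans below-sum (∏rootIndicator-≢minT t t≢min)))
    where
    E = belowTup-enum t
    componentwise : ∀ {n} {Ss : Vec (Subset N) n} (t : Tup Ss) →
                    ∏sumOf (weight 1ℤ) (belowCandidates t) ≡ ∏ rootIndicator t
    componentwise []ᵗ       = refl
    componentwise (a ∷ᵗ as) = cong₂ _*_ (sumOf-weight-below a (belowRT-enum a)) (componentwise as)
    below-sum : sumOf μᵗ (cartesian (belowCandidates t)) ≡ ∏ rootIndicator t
    below-sum = trans (sumOf-cartesian (weight 1ℤ) (belowCandidates t)) (componentwise t)

  Shallow : Tup Ss → Set
  Shallow []ᵗ       = ⊤
  Shallow (a ∷ᵗ as) = depth a ℕ.≤ 1 × Shallow as

  shallow? : (t : Tup Ss) → Dec (Shallow t)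
  shallow? []ᵗ       = yes tt
  shallow? (a ∷ᵗ as) = depth≤1? a ×-dec shallow? as

  Atomic⇔Shallow : (t : Tup Ss) → Atomic t ⇔ Shallow t
  Atomic⇔Shallow []ᵗ       = mk⇔ (λ _ → tt) (λ _ → tt)
  Atomic⇔Shallow (a ∷ᵗ as) = atomic⇔depth≤1 a ×-⇔ Atomic⇔Shallow as

  suppSize≤ : ∀ {n} {Ss : Vec (Subset N) n} (t : Tup Ss) → suppSize t ℕ.≤ n
  suppSize≤ []ᵗ                 = z≤n
  suppSize≤ (([] , _) ∷ᵗ as)    = ℕ.m≤n⇒m≤1+n (suppSize≤ as)
  suppSize≤ ((_ ∷ _ , _) ∷ᵗ as) = s≤s (suppSize≤ as)

  ∏weight-shallow : ∀ {n} {Ss : Vec (Subset N) n} (c : ℤ) (t : Tup Ss) → Shallow t →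
                    ∏ (weight c) t ≡ -1ℤ ^ suppSize t * c ^ (n ∸ suppSize t)
  ∏weight-shallow c []ᵗ _ = refl
  ∏weight-shallow {suc n} c (([] , _) ∷ᵗ as) (_ , sh) = begin
    c * ∏ (weight c) as
      ≡⟨ cong (c *_) (∏weight-shallow c as sh) ⟩
    c * (-1ℤ ^ s * c ^ (n ∸ s))
      ≡⟨ *-CSemigroup.x∙yz≈y∙xz c (-1ℤ ^ s) _ ⟩
    -1ℤ ^ s * c ^ suc (n ∸ s)
      ≡⟨ cong (λ e → -1ℤ ^ s * c ^ e) (sym (ℕ.+-∸-assoc 1 (suppSize≤ as))) ⟩
    -1ℤ ^ s * c ^ (suc n ∸ s) ∎
    where
    open ≡-Reasoning
    s = suppSize as
  ∏weight-shallow {suc n} c ((_ ∷ [] , _) ∷ᵗ as) (_ , sh) =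
    trans (cong (-1ℤ *_) (∏weight-shallow c as sh))
          (sym (ℤ.*-assoc -1ℤ (-1ℤ ^ suppSize as) (c ^ (n ∸ suppSize as))))
  ∏weight-shallow c ((_ ∷ _ ∷ _ , _) ∷ᵗ as) (s≤s () , _)

  ∏weight-deep : (c : ℤ) (t : Tup Ss) → ¬ Shallow t → ∏ (weight c) t ≡ 0ℤ
  ∏weight-deep c []ᵗ       ¬sh = ⊥-elim (¬sh tt)
  ∏weight-deep c (a ∷ᵗ as) ¬sh with depth≤1? a
  ... | no  a≰1 =
    trans (cong (_* ∏ (weight c) as) (weight-deep c a a≰1)) (ℤ.*-zeroˡ (∏ (weight c) as))
  ... | yes a≤1 =
    trans (cong (weight c a *_) (∏weight-deep c as (¬sh ∘ (a≤1 ,_)))) (ℤ.*-zeroʳ (weight c a))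

  μᵗ-shallow : ∀ {n} {Ss : Vec (Subset N) n} (t : Tup Ss) → Shallow t → μᵗ t ≡ -1ℤ ^ suppSize t
  μᵗ-shallow {n} t sh = trans (∏weight-shallow 1ℤ t sh)
    (trans (cong (-1ℤ ^ suppSize t *_) (ℤ.^-zeroˡ (n ∸ suppSize t))) (ℤ.*-identityʳ _))

-- Transversal functions

module Transversal {N : ℕ} (P : FinPoset N) {n : ℕ} {Ss : Vec (Subset N) n}
                   {f : FinPoset.Tup P Ss → Fin N} (transversal : FinPoset.IsTransversal P Ss f) where
  open FinPoset P
  open Poset P
  open RootedTrees P
  open IsTransversal transversal

  Lifting : Set
  Lifting = (x y : Fin N) → x ≤P y → (s : Tup Ss) → f s ≡ x →
            Σ[ t ∈ Tup Ss ] ((f t ≡ y) × (s ≤T t))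

  section : Fin N → Tup Ss
  section x = proj₁ (surjective x)

  f∘section : ∀ x → f (section x) ≡ x
  f∘section x = proj₂ (surjective x)

  quotient-iso : Lifting → IsoToQuotient Ss f
  quotient-iso lifting = section , f , (λ _ _ → id) , f∘section , f∘section ∘ f ,
    λ x y → mk⇔ (lift x y) (descend x y)
    where
    lift : ∀ x y → x ≤P y → section x ≤Q[ f ] section y
    lift x y x≤y with t , ft≡y , sx≤t ← lifting x y x≤y (section x) (f∘section x) =
      section x , t , refl , trans ft≡y (sym (f∘section y)) , sx≤t
    descend : ∀ x y → section x ≤Q[ f ] section y → x ≤P y
    descend x y (s , t , fs≡ , ft≡ , s≤t) =
      subst₂ _≤P_ (trans fs≡ (f∘section x)) (trans ft≡ (f∘section y)) (monotone s t s≤t)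

  module Conditions (ρ : Fin N → ℕ) (lifting : Lifting)
           (supp≡ρ : (x : Fin N) (t : Tup Ss) → f t ≡ x → Atomic t → suppSize t ≡ ρ x)
           (summation : (μT : Tup Ss → ℤ) → IsMobius _≤T_ (minT Ss) μT →
                        (x : Fin N) → x ≢ bot → SumsTo (InLowerIdeal f x) μT 0ℤ) where

    shallowTups : List (Tup Ss)
    shallowTups = filter shallow? (allTup Ss)

    shallowTups-enum : Enumerates shallowTups Shallow
    shallowTups-enum = enum-≐ (enum-filter (allTup-enum Ss) shallow?) (proj₂ , (tt ,_))

    atomicTransversals : Fin N → List (Tup Ss)
    atomicTransversals x = fibre Fin._≟_ f x shallowTups

    atomicTransversals-enum : ∀ x → Enumerates (atomicTransversals x) (λ t → Shallow t × f t ≡ x)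
    atomicTransversals-enum x = enum-filter shallowTups-enum (λ t → f t Fin.≟ x)

    supp≡ρ-shallow : ∀ t → Shallow t → suppSize t ≡ ρ (f t)
    supp≡ρ-shallow t sh = supp≡ρ (f t) t refl (Equivalence.from (Atomic⇔Shallow t) sh)

    signedCount : Fin N → ℤ
    signedCount x = -1ℤ ^ ρ x * + length (atomicTransversals x)

    sumOf-μᵗ-atomicTransversals : ∀ x → sumOf μᵗ (atomicTransversals x) ≡ signedCount x
    sumOf-μᵗ-atomicTransversals x =
      trans (sumOf-const (-1ℤ ^ ρ x) (atomicTransversals x) sign)
            (ℤ.*-comm (+ length (atomicTransversals x)) _)
      where
      sign : ∀ {t} → t ∈ atomicTransversals x → μᵗ t ≡ -1ℤ ^ ρ x
      sign {t} t∈ with sh , refl ← enum-sound (atomicTransversals-enum x) t∈ =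
        trans (μᵗ-shallow t sh) (cong (-1ℤ ^_) (supp≡ρ-shallow t sh))

    below : Fin N → List (Tup Ss)
    below x = filter (λ t → f t ≤? x) (allTup Ss)

    below-enum : ∀ x → Enumerates (below x) (λ t → f t ≤P x)
    below-enum x = enum-≐ (enum-filter (allTup-enum Ss) (λ t → f t ≤? x)) (proj₂ , (tt ,_))

    sumOf-signedCount : ∀ x {LB : List (Fin N)} → Enumerates LB (_≤P x) →
                        sumOf signedCount LB ≡ sumOf μᵗ (below x)
    sumOf-signedCount x {LB} E = begin
      sumOf signedCount LB
        ≡⟨ sumOf-cong LB (fibre-sum ∘ enum-sound E) ⟩
      sumOf (λ y → sumOf μᵗ (fibre Fin._≟_ f y atomicBelow)) LB
        ≡⟨ sumOf-fibres Fin._≟_ f μᵗ (proj₁ E) atomicBelow covered ⟩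
      sumOf μᵗ atomicBelow
        ≡⟨ sumOf-filter shallow? μᵗ (below x) (λ {t} _ → ∏weight-deep 1ℤ t) ⟩
      sumOf μᵗ (below x) ∎
      where
      open ≡-Reasoning
      atomicBelow = filter shallow? (below x)
      atomicBelow-enum = enum-filter (below-enum x) shallow?
      covered : ∀ {t} → t ∈ atomicBelow → f t ∈ LB
      covered = enum-complete E ∘ proj₁ ∘ enum-sound atomicBelow-enum
      fibre-sum : ∀ {y} → y ≤P x → signedCount y ≡ sumOf μᵗ (fibre Fin._≟_ f y atomicBelow)
      fibre-sum {y} y≤x = trans (sym (sumOf-μᵗ-atomicTransversals y))
        (sumOf-enum μᵗ (atomicTransversals-enum y)
          (enum-≐ (enum-filter atomicBelow-enum (λ t → f t Fin.≟ y))
                  ((λ ((_ , sh) , ft≡y) → sh , ft≡y) , λ { (sh , refl) → (y≤x , sh) , refl })))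

    f-minT : f (minT Ss) ≡ bot
    f-minT with t , ft≡bot ← surjective bot =
      subst (λ s → f s ≡ bot) (AllZero⇒≡minT t (zero-fibre t ft≡bot)) ft≡bot

    sumOf-below-bot : sumOf μᵗ (below bot) ≡ 1ℤ
    sumOf-below-bot = begin
      sumOf μᵗ (below bot)
        ≡⟨ sumOf-enum μᵗ (enum-≐ (below-enum bot) (only-minT , minT-below)) minT-enum ⟩
      μᵗ (minT Ss) + 0ℤ
        ≡⟨ ℤ.+-identityʳ _ ⟩
      μᵗ (minT Ss)
        ≡⟨ ∏-minT Ss (weight 1ℤ) refl ⟩
      1ℤ ∎
      where
      open ≡-Reasoning
      only-minT : ∀ {t} → f t ≤P bot → t ≡ minT Ss
      only-minT {t} ft≤bot = AllZero⇒≡minT t (zero-fibre t (≤-antisym ft≤bot (bot-min (f t))))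
      minT-below : ∀ {t} → t ≡ minT Ss → f t ≤P bot
      minT-below refl = subst (_≤P bot) (sym f-minT) ≤-refl
      minT-enum : Enumerates (minT Ss ∷ []) (_≡ minT Ss)
      minT-enum = [] ∷ [] , λ _ → mk⇔ (λ { (here t≡minT) → t≡minT ; (there ()) }) here

    sumOf-below-≢bot : ∀ {x} → x ≢ bot → sumOf μᵗ (below x) ≡ 0ℤ
    sumOf-below-≢bot {x} x≢bot = summation μᵗ (μᵗ-isMobius Ss) x x≢bot (below x)
      (enum-≐ (below-enum x) ( (λ {s} fs≤x → lifting (f s) x fs≤x s refl)
                             , (λ {s} (t , ft≡x , s≤t) → subst (f s ≤P_) ft≡x (monotone s t s≤t))))

    signedCount-isMobius : IsMobius _≤P_ bot signedCount
    signedCount-isMobius x = (λ { refl LB E → trans (sumOf-signedCount x E) sumOf-below-bot })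
                           , (λ x≢bot LB E → trans (sumOf-signedCount x E) (sumOf-below-≢bot x≢bot))

    mobius-atomicTransversals :
      (μ : Fin N → ℤ) → IsMobius _≤P_ bot μ → (x : Fin N) (k : ℕ) →
      Card (λ t → (f t ≡ x) × Atomic t) k → μ x ≡ -1ℤ ^ ρ x * + k
    mobius-atomicTransversals μ M x k (L , E , |L|≡k) =
      trans (mobius-unique M signedCount-isMobius x)
            (cong (λ l → -1ℤ ^ ρ x * + l) (trans (length-enum (atomicTransversals-enum x) E') |L|≡k))
      where
      E' = enum-≐ E ( (λ {t} (ft≡x , atomic) → Equivalence.to (Atomic⇔Shallow t) atomic , ft≡x)
                    , (λ {t} (sh , ft≡x) → ft≡x , Equivalence.from (Atomic⇔Shallow t) sh))

    sumOf-μᵗ*-atomicTransversals :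
      (μ : Fin N → ℤ) → IsMobius _≤P_ bot μ → (h : Fin N → ℤ) (x : Fin N) →
      sumOf (λ s → μᵗ s * h (f s)) (atomicTransversals x) ≡ μ x * h x
    sumOf-μᵗ*-atomicTransversals μ M h x = begin
      sumOf (λ s → μᵗ s * h (f s)) (atomicTransversals x)
        ≡⟨ sumOf-cong (atomicTransversals x) (λ {s} s∈ → cong (λ y → μᵗ s * h y) (f≡x s∈)) ⟩
      sumOf (λ s → μᵗ s * h x) (atomicTransversals x)
        ≡⟨ sumOf-*ʳ (h x) μᵗ (atomicTransversals x) ⟩
      sumOf μᵗ (atomicTransversals x) * h x
        ≡⟨ cong (_* h x) (sumOf-μᵗ-atomicTransversals x) ⟩
      signedCount x * h x
        ≡⟨ cong (_* h x) (sym (mobius-unique M signedCount-isMobius x)) ⟩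
      μ x * h x ∎
      where
      open ≡-Reasoning
      f≡x : ∀ {s} → s ∈ atomicTransversals x → f s ≡ x
      f≡x = proj₂ ∘ enum-sound (atomicTransversals-enum x)

    χ-term-shallow : (m : ℕ) → ((x : Fin N) → ρ x ℕ.≤ m) → (t : ℤ) {s : Tup Ss} → Shallow s →
                     t ^ n * (μᵗ s * t ^ (m ∸ ρ (f s))) ≡ t ^ m * ∏ (weight t) s
    χ-term-shallow m ρ≤m t {s} sh = begin
      t ^ n * (μᵗ s * t ^ (m ∸ ρ (f s)))
        ≡⟨ cong₂ (λ u e → t ^ n * (u * t ^ (m ∸ e))) (μᵗ-shallow s sh) (sym σ≡ρ) ⟩
      t ^ n * (-1ℤ ^ σ * t ^ (m ∸ σ))
        ≡⟨ *-CSemigroup.x∙yz≈y∙xz (t ^ n) (-1ℤ ^ σ) _ ⟩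
      -1ℤ ^ σ * (t ^ n * t ^ (m ∸ σ))
        ≡⟨ cong (-1ℤ ^ σ *_) (^-exchange t σ≤m (suppSize≤ s)) ⟩
      -1ℤ ^ σ * (t ^ m * t ^ (n ∸ σ))
        ≡⟨ *-CSemigroup.x∙yz≈y∙xz (-1ℤ ^ σ) (t ^ m) _ ⟩
      t ^ m * (-1ℤ ^ σ * t ^ (n ∸ σ))
        ≡⟨ cong (t ^ m *_) (sym (∏weight-shallow t s sh)) ⟩
      t ^ m * ∏ (weight t) s ∎
      where
      open ≡-Reasoning
      σ = suppSize s
      σ≡ρ = supp≡ρ-shallow s sh
      σ≤m = subst (ℕ._≤ m) (sym σ≡ρ) (ρ≤m (f s))

    characteristic-polynomial :
      (m : ℕ) → ((x : Fin N) → ρ x ℕ.≤ m) → (μ : Fin N → ℤ) → IsMobius _≤P_ bot μ →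
      (k : Fin n → ℕ) → ((i : Fin n) → Card (IsAtomRT {lookup Ss i}) (k i)) →
      (t : ℤ) → t ^ n * χ μ ρ m t ≡ t ^ m * prodℤ (map (λ i → t - + k i) (allFin n))
    characteristic-polynomial m ρ≤m μ M k atoms t = begin
      t ^ n * sumOf (λ x → μ x * h x) (allFin N)
        ≡⟨ cong (t ^ n *_) (sumOf-cong (allFin N) (λ _ → sym (sumOf-μᵗ*-atomicTransversals μ M h _))) ⟩
      t ^ n * sumOf (λ x → sumOf F (atomicTransversals x)) (allFin N)
        ≡⟨ cong (t ^ n *_) (sumOf-fibres Fin._≟_ f F (Unique.allFin⁺ N) shallowTups everyFibre) ⟩
      t ^ n * sumOf F shallowTups
        ≡⟨ sym (sumOf-*ˡ (t ^ n) F shallowTups) ⟩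
      sumOf (λ s → t ^ n * F s) shallowTups
        ≡⟨ sumOf-cong shallowTups (χ-term-shallow m ρ≤m t ∘ enum-sound shallowTups-enum) ⟩
      sumOf (λ s → t ^ m * ∏ (weight t) s) shallowTups
        ≡⟨ sumOf-*ˡ (t ^ m) (∏ (weight t)) shallowTups ⟩
      t ^ m * sumOf (∏ (weight t)) shallowTups
        ≡⟨ cong (t ^ m *_) (sumOf-filter shallow? _ (allTup Ss) (λ {s} _ → ∏weight-deep t s)) ⟩
      t ^ m * sumOf (∏ (weight t)) (allTup Ss)
        ≡⟨ cong (t ^ m *_) (sumOf-cartesian (weight t) (allCandidates Ss)) ⟩
      t ^ m * ∏sumOf (weight t) (allCandidates Ss)
        ≡⟨ cong (t ^ m *_) (∏sumOf-weight Ss t k atoms) ⟩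
      t ^ m * prodℤ (map (λ i → t - + k i) (allFin n)) ∎
      where
      open ≡-Reasoning
      h : Fin N → ℤ
      h x = t ^ (m ∸ ρ x)
      F : Tup Ss → ℤ
      F s = μᵗ s * h (f s)
      everyFibre : ∀ {s} → s ∈ shallowTups → f s ∈ allFin N
      everyFibre _ = ∈-allFin _

theorem7 : {N : ℕ} (P : FinPoset N) → let open FinPoset P in
    (ρ : Fin N → ℕ) (m : ℕ) → ((x : Fin N) → ρ x ℕ.≤ m) →
    (n : ℕ) (Ss : Vec (Subset N) n) → ((i : Fin n) → bot ∈ₛ lookup Ss i) →
    (f : Tup Ss → Fin N) → IsTransversal Ss f →
    ((x y : Fin N) → x ≤P y → (s : Tup Ss) → f s ≡ x →
       Σ[ t ∈ Tup Ss ] ((f t ≡ y) × (s ≤T t))) →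
    ((x : Fin N) (t : Tup Ss) → f t ≡ x → Atomic t → suppSize t ≡ ρ x) →
    ((μT : Tup Ss → ℤ) → IsMobius _≤T_ (minT Ss) μT →
       (x : Fin N) → x ≢ bot → SumsTo (InLowerIdeal f x) μT 0ℤ) →
    IsoToQuotient Ss f
    × ((μ : Fin N → ℤ) → IsMobius _≤P_ bot μ →
         (x : Fin N) (k : ℕ) → Card (λ t → (f t ≡ x) × Atomic t) k →
         μ x ≡ (-1ℤ ^ ρ x) * (+ k))
    × ((μ : Fin N → ℤ) → IsMobius _≤P_ bot μ →
         (a : Fin n → ℕ) → ((i : Fin n) → Card (IsAtomRT {lookup Ss i}) (a i)) →
         (t : ℤ) → (t ^ n) * χ μ ρ m t ≡ (t ^ m) * prodℤ (map (λ i → t - (+ a i)) (allFin n)))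
theorem7 P ρ m ρ≤m n Ss _ f transversal lifting supp≡ρ summation =
  quotient-iso lifting , mobius-atomicTransversals , characteristic-polynomial m ρ≤m
  where
  open Transversal P transversal
  open Conditions ρ lifting supp≡ρ summation
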